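{- Fix any deterministic valuation sequence $V_1,\ldots,V_T$. For all $t\in\{1,\ldots,T\}$, $k'\in\{0,\ldots,k\}$ with $\Pr[I^{\mathsf{A1'}}_{t-1}=k']>0$, and $j\in\{1,\ldots,m+1\}$, $\Pr[P^{\mathsf{A1'}}_t=r^{(j)}\mid I^{\mathsf{A1'}}_{t-1}=k']=\Pr[P^{\mathsf{A1}}_t=r^{(j)}\mid I^{\mathsf{A1}}_{t-1}=k']$. Moreover, for all $t\in\{0,\ldots,T\}$ and $k'\in\{0,\ldots,k\}$, $\Pr[I^{\mathsf{A1'}}_t=k']=\Pr[I^{\mathsf{A1}}_t=k']$.
   Context: Setting (single-item dynamic pricing, public pricing, deterministic valuations). Fix $m\ge1$, prices $0<r^{(1)}<\cdots<r^{(m)}$, $\mathcal{P}=\{r^{(1)},\ldots,r^{(m)}\}$, $r^{(0)}=0$, $r^{(m+1)}=\infty$, and inventory $k\ge1$. Customers $t=1,\ldots,T$ have valuations $V_t\in\{r^{(0)},\ldots,r^{(m)}\}$; an online algorithm chooses a (possibly random) price $P_t\in\{r^{(1)},\ldots,r^{(m+1)}\}$ using only past prices and valuations; $X_t=\mathbb{1}(V_t\ge P_t)$; $I_t=k-\sum_{t'\le t}X_{t'}$ is remaining inventory at end of time $t$ ($I_0=k$). Let $q^{(j)}=1-r^{(j-1)}/r^{(j)}$. For an algorithm $\mathcal{A}$, superscript $\mathcal{A}$ denotes the random variables of its run; $\mathsf{A1}$ denotes Algorithm VT and $\mathsf{A1'}$ denotes Algorithm VT$'$. Algorithm VT: initialize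 $\mathtt{level}[i]=0$, $\mathtt{sold}[i]=\mathtt{false}$ for $i=1,\ldots,k$. For each customer $t$: let $i^*_t$ minimize $\mathtt{level}[i]$ (fixed deterministic tie-breaking), and $\ell_t$ satisfy $\mathtt{level}[i^*_t]=r^{(\ell_t)}$. If $\mathtt{sold}[i^*_t]=\mathtt{false}$, choose price $r^{(j)}$, $j\in\{\ell_t+1,\ldots,m\}$, w.p. $q^{(j)}/\sum_{j'=\ell_t+1}^mq^{(j')}$; else price $\infty$. Then observe $V_t,X_t$, set $\mathtt{level}[i^*_t]=\max\{\mathtt{level}[i^*_t],V_t\}$, and if $X_t=1$ set $\mathtt{sold}[i^*_t]=\mathtt{true}$. Algorithm VT$'$: at time $t$, with its own remaining inventory $I_{t-1}$, compute $i^*_t,\ell_t$ as in Algorithm VT from $V_1,\ldots,V_{t-1}$; let $\gamma_t$ be the probability that $\mathtt{sold}[i^*_t]=\mathtt{true}$ in a run of Algorithm VT conditioned on that run having $I_{t-1}$ units remaining at the end of time $t-1$. With probability $1-\gamma_t$ offer a price drawn from the distribution Algorithm VT uses when $\mathtt{sold}[i^*_t]=\mathtt{false}$; with probability $\gamma_t$ offer $\infty$.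
   Formalization: The prices $r^{(1)},\ldots,r^{(m)}$ are rational. -}

module Defs where

open import Data.Nat as ℕ using (ℕ; zero; suc; _∸_; _≤ᵇ_; _≡ᵇ_)
open import Data.Fin using (Fin; toℕ) renaming (zero to fzero)
open import Data.Bool using (Bool; true; false; if_then_else_; _∧_)
open import Data.List using (List; []; _∷_; _++_; map; concatMap; foldr; take; upTo)
open import Data.Vec as Vec using (Vec; lookup; replicate; _[_]≔_; toList)
open import Data.Product using (_×_; _,_; proj₁; proj₂)
open import Data.Rational as ℚ using (ℚ; 0ℚ; 1ℚ; _+_; _*_; _-_; _÷_; ≢-nonZero)
open import Data.Rational.Properties using (_≟_)
open import Relation.Nullary using (yes; no)

Dist : Set → Set
Dist A = List (ℚ × A)

ret : {A : Set} → A → Dist A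
ret a = (1ℚ , a) ∷ []

bindD : {A B : Set} → Dist A → (A → Dist B) → Dist B
bindD d f = concatMap (λ wa → map (λ wb → (proj₁ wa * proj₁ wb , proj₂ wb)) (f (proj₂ wa))) d

mapD : {A B : Set} → (A → B) → Dist A → Dist B
mapD f = map (λ wa → (proj₁ wa , f (proj₂ wa)))

scale : {A : Set} → ℚ → Dist A → Dist A
scale c = map (λ wa → (c * proj₁ wa , proj₂ wa))

Pr : {A : Set} → Dist A → (A → Bool) → ℚ
Pr d E = foldr (λ wa acc → (if E (proj₂ wa) then proj₁ wa else 0ℚ) + acc) 0ℚ d

-- division, with the (never used in a meaningful way) convention x/0 = 0
divQ : ℚ → ℚ → ℚ
divQ a b with b ≟ 0ℚ
... | yes _ = 0ℚ
... | no b≢0 = _÷_ a b {{≢-nonZero b≢0}}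

-- conditional probability Pr[E | F]  (= 0 by convention if Pr[F] = 0)
Cond : {A : Set} → Dist A → (A → Bool) → (A → Bool) → ℚ
Cond d E F = divQ (Pr d (λ a → E a ∧ F a)) (Pr d F)

sumQ : List ℚ → ℚ
sumQ = foldr _+_ 0ℚ

-- Prices r^(0) = 0 < r^(1) < ... < r^(m) are given by r : ℕ → ℚ (only
-- r 0, ..., r m matter).  A price r^(j), j ∈ {1,...,m+1}, is represented
-- by its index j; index m+1 stands for r^(m+1) = ∞.  A valuation
-- V ∈ {r^(0),...,r^(m)} is represented by its index in Fin (suc m).

qq : (r : ℕ → ℚ) → ℕ → ℚ
qq r j = 1ℚ - divQ (r (j ∸ 1)) (r j)

-- the price distribution used by VT when sold[i*] = false and the level
-- is r^(ℓ): r^(j), j ∈ {ℓ+1..m}, w.p. q^(j) / Σ_{j'=ℓ+1}^m q^(j').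
-- (If the range is empty, i.e. ℓ = m, which is unreachable, offer ∞.)
offerDist : (m : ℕ) (r : ℕ → ℚ) (ℓ : ℕ) → Dist ℕ
offerDist m r ℓ =
  if m ≤ᵇ ℓ then ret (suc m)
  else map (λ j → (divQ (qq r j) tot , j)) js
  where
  js : List ℕ
  js = map (λ i → suc ℓ ℕ.+ i) (upTo (m ∸ ℓ))
  tot : ℚ
  tot = sumQ (map (qq r) js)

-- X = 1(V ≥ P) for price index p and valuation index v
sells : (m : ℕ) → Fin (suc m) → ℕ → Bool
sells m v p = (p ≤ᵇ m) ∧ (p ≤ᵇ toℕ v)

maxF : {m : ℕ} → Fin (suc m) → Fin (suc m) → Fin (suc m)
maxF a b = if toℕ a ≤ᵇ toℕ b then b else a

IsMinChoice : {m k : ℕ} → (Vec (Fin (suc m)) k → Fin k) → Set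
IsMinChoice {m} {k} choose =
  (lv : Vec (Fin (suc m)) k) (i : Fin k) →
  toℕ (lookup lv (choose lv)) ℕ.≤ toℕ (lookup lv i)

-- Algorithm VT (A1).  State: levels (as price indices), sold flags, and
-- number of units sold so far (so that I = k - cnt).

record StVT (m k : ℕ) : Set where
  constructor stVT
  field
    lv  : Vec (Fin (suc m)) k
    sd  : Vec Bool k
    cnt : ℕ
open StVT public

initVT : (m k : ℕ) → StVT m k
initVT m k = stVT (replicate k fzero) (replicate k false) 0

stepVT : (m k : ℕ) (r : ℕ → ℚ) (choose : Vec (Fin (suc m)) k → Fin k) →
         StVT m k → Fin (suc m) → Dist (ℕ × StVT m k)
stepVT m k r choose s v = mapD next pd
  where
  i = choose (lv s)
  ℓ = lookup (lv s) i
  pd : Dist ℕ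
  pd = if lookup (sd s) i then ret (suc m) else offerDist m r (toℕ ℓ)
  next : ℕ → ℕ × StVT m k
  next p = p , stVT (lv s [ i ]≔ maxF ℓ v)
                    (if sells m v p then sd s [ i ]≔ true else sd s)
                    (cnt s ℕ.+ (if sells m v p then 1 else 0))

-- Algorithm VT' (A1').  State: levels (deterministic, computed exactly as
-- in VT from the past valuations) and its own number of units sold.

record StVT' (m k : ℕ) : Set where
  constructor stVT'
  field
    lv'  : Vec (Fin (suc m)) k
    cnt' : ℕ
open StVT' public

initVT' : (m k : ℕ) → StVT' m k
initVT' m k = stVT' (replicate k fzero) 0

-- γ_t : probability that sold[i*_t] = true in a run of VT (distribution d
-- of its state at the end of time t-1) conditioned on that run having the
-- same remaining inventory I_{t-1} = k - cnt' as VT'.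
gammaVT : (m k : ℕ) (choose : Vec (Fin (suc m)) k → Fin k) →
          Dist (StVT m k) → StVT' m k → ℚ
gammaVT m k choose d s' =
  Cond d (λ s → lookup (sd s) (choose (lv s))) (λ s → cnt s ≡ᵇ cnt' s')

stepVT' : (m k : ℕ) (r : ℕ → ℚ) (choose : Vec (Fin (suc m)) k → Fin k) →
          Dist (StVT m k) → StVT' m k → Fin (suc m) → Dist (ℕ × StVT' m k)
stepVT' m k r choose d s' v = mapD next pd
  where
  i = choose (lv' s')
  ℓ = lookup (lv' s') i
  g = gammaVT m k choose d s'
  pd : Dist ℕ
  pd = scale (1ℚ - g) (offerDist m r (toℕ ℓ)) ++ scale g (ret (suc m))
  next : ℕ → ℕ × StVT' m k
  next p = p , stVT' (lv' s' [ i ]≔ maxF ℓ v)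
                     (cnt' s' ℕ.+ (if sells m v p then 1 else 0))

runs : (m k : ℕ) (r : ℕ → ℚ) (choose : Vec (Fin (suc m)) k → Fin k) →
       Dist (StVT m k) × Dist (StVT' m k) → List (Fin (suc m)) →
       Dist (StVT m k) × Dist (StVT' m k)
runs m k r choose dd [] = dd
runs m k r choose (d , d') (v ∷ vs) =
  runs m k r choose
    ( bindD d (λ s → mapD proj₂ (stepVT m k r choose s v))
    , bindD d' (λ s' → mapD proj₂ (stepVT' m k r choose d s' v)) ) vs

-- state distributions at the end of time t (after customers 1..t)
distsAt : (m k : ℕ) (r : ℕ → ℚ) (choose : Vec (Fin (suc m)) k → Fin k) →
          {T : ℕ} → Vec (Fin (suc m)) T → ℕ → Dist (StVT m k) × Dist (StVT' m k)
distsAt m k r choose Vs t =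
  runs m k r choose (ret (initVT m k) , ret (initVT' m k)) (take t (toList Vs))

-- Time t ∈ {1..T} is represented by t : Fin T (t = toℕ t + 1).
-- Joint distribution of (P_t , number sold by end of time t-1).
jointVT : (m k : ℕ) (r : ℕ → ℚ) (choose : Vec (Fin (suc m)) k → Fin k) →
          {T : ℕ} → Vec (Fin (suc m)) T → Fin T → Dist (ℕ × ℕ)
jointVT m k r choose Vs t =
  bindD (proj₁ (distsAt m k r choose Vs (toℕ t)))
        (λ s → mapD (λ ps → proj₁ ps , cnt s) (stepVT m k r choose s (lookup Vs t)))

jointVT' : (m k : ℕ) (r : ℕ → ℚ) (choose : Vec (Fin (suc m)) k → Fin k) →
           {T : ℕ} → Vec (Fin (suc m)) T → Fin T → Dist (ℕ × ℕ)
jointVT' m k r choose Vs t =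
  let dd = distsAt m k r choose Vs (toℕ t) in
  bindD (proj₂ dd)
        (λ s' → mapD (λ ps → proj₁ ps , cnt' s')
                     (stepVT' m k r choose (proj₁ dd) s' (lookup Vs t)))

-- events
-- I = k' where I = k - (units sold)
invIs : (k k' c : ℕ) → Bool
invIs k k' c = (c ℕ.+ k') ≡ᵇ k

PrInvVT : (m k : ℕ) (r : ℕ → ℚ) (choose : Vec (Fin (suc m)) k → Fin k) →
          {T : ℕ} → Vec (Fin (suc m)) T → ℕ → ℕ → ℚ
PrInvVT m k r choose Vs t k' =
  Pr (proj₁ (distsAt m k r choose Vs t)) (λ s → invIs k k' (cnt s))

PrInvVT' : (m k : ℕ) (r : ℕ → ℚ) (choose : Vec (Fin (suc m)) k → Fin k) →
           {T : ℕ} → Vec (Fin (suc m)) T → ℕ → ℕ → ℚ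
PrInvVT' m k r choose Vs t k' =
  Pr (proj₂ (distsAt m k r choose Vs t)) (λ s → invIs k k' (cnt' s))

CondPriceVT : (m k : ℕ) (r : ℕ → ℚ) (choose : Vec (Fin (suc m)) k → Fin k) →
              {T : ℕ} → Vec (Fin (suc m)) T → Fin T → ℕ → ℕ → ℚ
CondPriceVT m k r choose Vs t k' j =
  Cond (jointVT m k r choose Vs t) (λ pc → proj₁ pc ≡ᵇ j) (λ pc → invIs k k' (proj₂ pc))

CondPriceVT' : (m k : ℕ) (r : ℕ → ℚ) (choose : Vec (Fin (suc m)) k → Fin k) →
               {T : ℕ} → Vec (Fin (suc m)) T → Fin T → ℕ → ℕ → ℚ
CondPriceVT' m k r choose Vs t k' j =
  Cond (jointVT' m k r choose Vs t) (λ pc → proj₁ pc ≡ᵇ j) (λ pc → invIs k k' (proj₂ pc))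

module Submission where

-- Both algorithms update the levels deterministically from the
-- valuations, so at every time all states of VT and of VT' share one level
-- vector L, hence one unit i* and one offer distribution O.  Given the state
-- s, VT offers ∞ if sold[i*] holds and a draw from O otherwise; VT' offers ∞
-- with probability γ(c) = Pr[sold[i*] | I = c] and a draw from O otherwise,
-- where c is its own sales count.  Taking the conditional expectation given
-- the sales count (the "tower" lemma below) turns the indicator of sold[i*]
-- into γ(c), so as long as the sales counts of VT and VT' have the same law,
-- the joint laws of (offered price, sales count) coincide.  This yields both
-- claims: the conditional price laws agree, and, since the new sales count
-- is a function of (price, old count), equality of the count laws is
-- preserved from one customer to the next.

open import Defs
open import Data.Nat using (ℕ; suc; _≤_; _<_)
open import Data.Fin using (Fin; toℕ)
open import Data.Vec using (Vec)
open import Data.Product using (_×_)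
open import Data.Rational using (ℚ; 0ℚ)
import Data.Rational
open import Relation.Binary.PropositionalEquality using (_≡_)

open import Data.Nat as Nat using (zero; z≤n; s≤s; _⊔_; _≡ᵇ_; _∸_)
import Data.Nat.Properties as NP
open import Data.Rational as Q using (1ℚ; _+_; _*_; _-_; -_; 1/_)
import Data.Rational.Properties as QP
open import Data.Rational.Solver using (module +-*-Solver)
open import Data.Bool using (Bool; true; false; if_then_else_; _∧_)
open import Data.List using (List; []; _∷_; _++_; map; foldr; upTo; take)
open import Data.List.Relation.Unary.All as All using (All; []; _∷_)
import Data.List.Relation.Unary.All.Properties as AllP
open import Data.Product using (_,_; proj₁; proj₂)
open import Data.Sum using (inj₁; inj₂)
open import Data.Empty using (⊥-elim)
open import Data.Vec using (lookup; _[_]≔_; replicate; toList)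
open import Relation.Nullary using (yes; no; ¬_)
open import Relation.Binary.PropositionalEquality
  using (refl; sym; trans; cong; cong₂; subst; subst₂; module ≡-Reasoning)
open +-*-Solver

-- Expectations over finite distributions

𝔼 : {A : Set} → Dist A → (A → ℚ) → ℚ
𝔼 d h = foldr (λ wa acc → proj₁ wa * h (proj₂ wa) + acc) 0ℚ d

ind : Bool → ℚ
ind b = if b then 1ℚ else 0ℚ

ind-∧ : ∀ b c → ind (b ∧ c) ≡ ind b * ind c
ind-∧ true c = sym (QP.*-identityˡ (ind c))
ind-∧ false c = sym (QP.*-zeroˡ (ind c))

Pr≡𝔼 : {A : Set} (d : Dist A) (E : A → Bool) → Pr d E ≡ 𝔼 d (λ a → ind (E a))
Pr≡𝔼 [] E = refl
Pr≡𝔼 ((w , a) ∷ d) E with E a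
... | true = cong₂ _+_ (sym (QP.*-identityʳ w)) (Pr≡𝔼 d E)
... | false = cong₂ _+_ (sym (QP.*-zeroʳ w)) (Pr≡𝔼 d E)

𝔼-cong : {A : Set} (d : Dist A) (h h' : A → ℚ) →
         All (λ wa → h (proj₂ wa) ≡ h' (proj₂ wa)) d → 𝔼 d h ≡ 𝔼 d h'
𝔼-cong [] h h' [] = refl
𝔼-cong ((w , a) ∷ d) h h' (e ∷ es) = cong₂ (λ x y → w * x + y) e (𝔼-cong d h h' es)

𝔼-congᵘ : {A : Set} (d : Dist A) (h h' : A → ℚ) → (∀ a → h a ≡ h' a) → 𝔼 d h ≡ 𝔼 d h'
𝔼-congᵘ d h h' eq = 𝔼-cong d h h' (All.universal (λ wa → eq (proj₂ wa)) d)

𝔼-+ : {A : Set} (d : Dist A) (h h' : A → ℚ) → 𝔼 d (λ a → h a + h' a) ≡ 𝔼 d h + 𝔼 d h'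
𝔼-+ [] h h' = sym (QP.+-identityˡ 0ℚ)
𝔼-+ ((w , a) ∷ d) h h' rewrite 𝔼-+ d h h' =
  solve 5 (λ w x y u v → w :* (x :+ y) :+ (u :+ v) := (w :* x :+ u) :+ (w :* y :+ v))
        refl w (h a) (h' a) (𝔼 d h) (𝔼 d h')

𝔼-* : {A : Set} (d : Dist A) (c : ℚ) (h : A → ℚ) → 𝔼 d (λ a → c * h a) ≡ c * 𝔼 d h
𝔼-* [] c h = sym (QP.*-zeroʳ c)
𝔼-* ((w , a) ∷ d) c h rewrite 𝔼-* d c h =
  solve 4 (λ w c x u → w :* (c :* x) :+ c :* u := c :* (w :* x :+ u)) refl w c (h a) (𝔼 d h)

𝔼-++ : {A : Set} (xs ys : Dist A) (h : A → ℚ) → 𝔼 (xs ++ ys) h ≡ 𝔼 xs h + 𝔼 ys h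
𝔼-++ [] ys h = sym (QP.+-identityˡ _)
𝔼-++ ((w , a) ∷ xs) ys h =
  trans (cong (w * h a +_) (𝔼-++ xs ys h)) (sym (QP.+-assoc (w * h a) (𝔼 xs h) (𝔼 ys h)))

𝔼-scale : {A : Set} (c : ℚ) (d : Dist A) (h : A → ℚ) → 𝔼 (scale c d) h ≡ c * 𝔼 d h
𝔼-scale c [] h = sym (QP.*-zeroʳ c)
𝔼-scale c ((w , a) ∷ d) h =
  trans (cong₂ _+_ (QP.*-assoc c w (h a)) (𝔼-scale c d h)) (sym (QP.*-distribˡ-+ c _ _))

𝔼-ret : {A : Set} (a : A) (h : A → ℚ) → 𝔼 (ret a) h ≡ h a
𝔼-ret a h = trans (QP.+-identityʳ _) (QP.*-identityˡ _)

𝔼-mapD : {A B : Set} (g : A → B) (d : Dist A) (h : B → ℚ) →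
         𝔼 (mapD g d) h ≡ 𝔼 d (λ a → h (g a))
𝔼-mapD g [] h = refl
𝔼-mapD g ((w , a) ∷ d) h = cong (w * h (g a) +_) (𝔼-mapD g d h)

𝔼-bind-map : {A B C : Set} (d : Dist A) (D : A → Dist B) (F : A → B → C) (h : C → ℚ) →
             𝔼 (bindD d (λ a → mapD (F a) (D a))) h ≡ 𝔼 d (λ a → 𝔼 (D a) (λ b → h (F a b)))
𝔼-bind-map [] D F h = refl
𝔼-bind-map ((w , a) ∷ d) D F h = begin
    𝔼 (scale w (mapD (F a) (D a)) ++ bindD d (λ a → mapD (F a) (D a))) h
  ≡⟨ 𝔼-++ (scale w (mapD (F a) (D a))) _ h ⟩
    𝔼 (scale w (mapD (F a) (D a))) h + 𝔼 (bindD d (λ a → mapD (F a) (D a))) h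
  ≡⟨ cong₂ _+_ (trans (𝔼-scale w (mapD (F a) (D a)) h) (cong (w *_) (𝔼-mapD (F a) (D a) h)))
               (𝔼-bind-map d D F h) ⟩
    w * 𝔼 (D a) (λ b → h (F a b)) + 𝔼 d (λ a → 𝔼 (D a) (λ b → h (F a b)))
  ∎
  where open ≡-Reasoning

-- Distributions all of whose weights are nonnegative; nonnegativity is what
-- makes Pr[F] = 0 force Pr[P ∧ F] = 0 when conditioning.
Nonneg : {A : Set} → Dist A → Set
Nonneg = All (λ wa → 0ℚ Q.≤ proj₁ wa)

0≤1 : 0ℚ Q.≤ 1ℚ
0≤1 = QP.nonNegative⁻¹ 1ℚ

0≤* : ∀ {x y} → 0ℚ Q.≤ x → 0ℚ Q.≤ y → 0ℚ Q.≤ x * y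
0≤* {x} {y} 0≤x 0≤y =
  QP.nonNegative⁻¹ (x * y) {{QP.nonNeg*nonNeg⇒nonNeg x {{Q.nonNegative 0≤x}} y {{Q.nonNegative 0≤y}}}}

0≤+ : ∀ {x y} → 0ℚ Q.≤ x → 0ℚ Q.≤ y → 0ℚ Q.≤ x + y
0≤+ {x} {y} 0≤x 0≤y = subst (Q._≤ x + y) (QP.+-identityˡ 0ℚ) (QP.+-mono-≤ 0≤x 0≤y)

Nonneg-if : {A : Set} (b : Bool) {d₁ d₂ : Dist A} → Nonneg d₁ → Nonneg d₂ →
            Nonneg (if b then d₁ else d₂)
Nonneg-if true n₁ n₂ = n₁
Nonneg-if false n₁ n₂ = n₂

bind⁺ : {A B : Set} {P : ℚ × B → Set} (d : Dist A) (f : A → Dist B) →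
        All (λ wa → All P (scale (proj₁ wa) (f (proj₂ wa)))) d → All P (bindD d f)
bind⁺ [] f [] = []
bind⁺ (_ ∷ d) f (p ∷ ps) = AllP.++⁺ p (bind⁺ d f ps)

Nonneg-bind : {A B : Set} (d : Dist A) (f : A → Dist B) →
              Nonneg d → (∀ a → Nonneg (f a)) → Nonneg (bindD d f)
Nonneg-bind d f nd nf =
  bind⁺ d f (All.map (λ {wa} 0≤w → AllP.map⁺ (All.map (0≤* 0≤w) (nf (proj₂ wa)))) nd)

support-bind : {A B : Set} {P : B → Set} (d : Dist A) (f : A → Dist B) →
               All (λ wa → All (λ wb → P (proj₂ wb)) (f (proj₂ wa))) d →
               All (λ wb → P (proj₂ wb)) (bindD d f)
support-bind d f ps = bind⁺ d f (All.map AllP.map⁺ ps)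

𝔼-nonneg : {A : Set} (d : Dist A) (h : A → ℚ) → Nonneg d →
           (∀ a → 0ℚ Q.≤ h a) → 0ℚ Q.≤ 𝔼 d h
𝔼-nonneg [] h [] _ = QP.≤-refl
𝔼-nonneg ((w , a) ∷ d) h (0≤w ∷ nd) 0≤h = 0≤+ (0≤* 0≤w (0≤h a)) (𝔼-nonneg d h nd 0≤h)

𝔼-mono : {A : Set} (d : Dist A) (h h' : A → ℚ) → Nonneg d →
         (∀ a → h a Q.≤ h' a) → 𝔼 d h Q.≤ 𝔼 d h'
𝔼-mono [] h h' [] _ = QP.≤-refl
𝔼-mono ((w , a) ∷ d) h h' (0≤w ∷ nd) h≤h' =
  QP.+-mono-≤ (QP.*-monoˡ-≤-nonNeg w {{Q.nonNegative 0≤w}} (h≤h' a)) (𝔼-mono d h h' nd h≤h')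

-- Decomposing an expectation along a ℕ-valued key

sumTo : ℕ → (ℕ → ℚ) → ℚ
sumTo zero g = g 0
sumTo (suc N) g = sumTo N g + g (suc N)

sumTo-cong : ∀ N (g g' : ℕ → ℚ) → (∀ n → g n ≡ g' n) → sumTo N g ≡ sumTo N g'
sumTo-cong zero g g' eq = eq 0
sumTo-cong (suc N) g g' eq = cong₂ _+_ (sumTo-cong N g g' eq) (eq (suc N))

𝔼-sumTo : {A : Set} (d : Dist A) (N : ℕ) (g : ℕ → A → ℚ) →
          𝔼 d (λ a → sumTo N (λ n → g n a)) ≡ sumTo N (λ n → 𝔼 d (g n))
𝔼-sumTo d zero g = refl
𝔼-sumTo d (suc N) g =
  trans (𝔼-+ d (λ a → sumTo N (λ n → g n a)) (g (suc N)))
        (cong (_+ 𝔼 d (g (suc N))) (𝔼-sumTo d N g))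

ind-≡ᵇ-refl : ∀ n → ind (n ≡ᵇ n) ≡ 1ℚ
ind-≡ᵇ-refl zero = refl
ind-≡ᵇ-refl (suc n) = ind-≡ᵇ-refl n

ind-≡ᵇ-≢ : ∀ c n → ¬ c ≡ n → ind (c ≡ᵇ n) ≡ 0ℚ
ind-≡ᵇ-≢ zero zero c≢n = ⊥-elim (c≢n refl)
ind-≡ᵇ-≢ zero (suc n) _ = refl
ind-≡ᵇ-≢ (suc c) zero _ = refl
ind-≡ᵇ-≢ (suc c) (suc n) c≢n = ind-≡ᵇ-≢ c n (λ eq → c≢n (cong suc eq))

localize : ∀ c n (G : ℕ → ℚ) → ind (c ≡ᵇ n) * G c ≡ G n * ind (c ≡ᵇ n)
localize c n G with c Nat.≟ n
... | yes refl = QP.*-comm (ind (c ≡ᵇ c)) (G c)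
... | no c≢n rewrite ind-≡ᵇ-≢ c n c≢n = trans (QP.*-zeroˡ (G c)) (sym (QP.*-zeroʳ (G n)))

sumTo-miss : ∀ N c x → N < c → sumTo N (λ n → ind (c ≡ᵇ n) * x) ≡ 0ℚ
sumTo-miss zero c x 0<c =
  trans (cong (_* x) (ind-≡ᵇ-≢ c 0 (λ { refl → NP.<-irrefl refl 0<c }))) (QP.*-zeroˡ x)
sumTo-miss (suc N) c x N<c = begin
    sumTo N (λ n → ind (c ≡ᵇ n) * x) + ind (c ≡ᵇ suc N) * x
  ≡⟨ cong₂ _+_ (sumTo-miss N c x (NP.<-trans (NP.n<1+n N) N<c))
               (cong (_* x) (ind-≡ᵇ-≢ c (suc N) (λ { refl → NP.<-irrefl refl N<c }))) ⟩
    0ℚ + 0ℚ * x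
  ≡⟨ trans (QP.+-identityˡ _) (QP.*-zeroˡ x) ⟩
    0ℚ
  ∎
  where open ≡-Reasoning

sumTo-hit : ∀ N c x → c ≤ N → sumTo N (λ n → ind (c ≡ᵇ n) * x) ≡ x
sumTo-hit zero .zero x z≤n = QP.*-identityˡ x
sumTo-hit (suc N) c x c≤1+N with NP.m≤n⇒m<n∨m≡n c≤1+N
... | inj₁ c<1+N =
  trans (cong₂ _+_ (sumTo-hit N c x (NP.m<1+n⇒m≤n c<1+N))
                   (cong (_* x) (ind-≡ᵇ-≢ c (suc N) (λ { refl → NP.<-irrefl refl c<1+N }))))
        (trans (cong (x +_) (QP.*-zeroˡ x)) (QP.+-identityʳ x))
... | inj₂ refl =
  trans (cong₂ _+_ (sumTo-miss N (suc N) x (NP.n<1+n N))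
                   (cong (_* x) (ind-≡ᵇ-refl N)))
        (trans (QP.+-identityˡ _) (QP.*-identityˡ x))

maxKey : {A : Set} → (A → ℕ) → Dist A → ℕ
maxKey κ d = foldr (λ wa acc → κ (proj₂ wa) ⊔ acc) 0 d

maxKey-bound : {A : Set} (κ : A → ℕ) (d : Dist A) → All (λ wa → κ (proj₂ wa) ≤ maxKey κ d) d
maxKey-bound κ [] = []
maxKey-bound κ (wa ∷ d) =
  NP.m≤m⊔n _ _ ∷ All.map (λ le → NP.≤-trans le (NP.m≤n⊔m (κ (proj₂ wa)) _)) (maxKey-bound κ d)

decompose : {A : Set} (κ : A → ℕ) (d : Dist A) (h : A → ℚ) →
            𝔼 d h ≡ sumTo (maxKey κ d) (λ n → 𝔼 d (λ a → ind (κ a ≡ᵇ n) * h a))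
decompose κ d h =
  trans (𝔼-cong d h (λ a → sumTo N (λ n → ind (κ a ≡ᵇ n) * h a))
                (All.map (λ {wa} le → sym (sumTo-hit N (κ (proj₂ wa)) (h (proj₂ wa)) le))
                         (maxKey-bound κ d)))
        (𝔼-sumTo d N (λ n a → ind (κ a ≡ᵇ n) * h a))
  where N = maxKey κ d

-- Conditioning

divQ-cancel : ∀ a b → (b ≡ 0ℚ → a ≡ 0ℚ) → divQ a b * b ≡ a
divQ-cancel a b null with b QP.≟ 0ℚ
... | yes b≡0 = trans (QP.*-zeroˡ b) (sym (null b≡0))
... | no b≢0 = begin
    a * (1/ b) {{Q.≢-nonZero b≢0}} * b
  ≡⟨ QP.*-assoc a _ b ⟩
    a * ((1/ b) {{Q.≢-nonZero b≢0}} * b)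
  ≡⟨ cong (a *_) (QP.*-inverseˡ b {{Q.≢-nonZero b≢0}}) ⟩
    a * 1ℚ
  ≡⟨ QP.*-identityʳ a ⟩
    a
  ∎
  where open ≡-Reasoning

Cond-cancel : {A : Set} (d : Dist A) → Nonneg d → (P F : A → Bool) →
              Cond d P F * Pr d F ≡ Pr d (λ a → P a ∧ F a)
Cond-cancel d nd P F = divQ-cancel (Pr d P∧F) (Pr d F) null
  where
  P∧F : _ → Bool
  P∧F a = P a ∧ F a
  ind-∧-≤ : ∀ b c → ind (b ∧ c) Q.≤ ind c
  ind-∧-≤ true c = QP.≤-refl
  ind-∧-≤ false true = 0≤1
  ind-∧-≤ false false = QP.≤-refl
  ind-nonneg : ∀ b → 0ℚ Q.≤ ind b
  ind-nonneg true = 0≤1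
  ind-nonneg false = QP.≤-refl
  null : Pr d F ≡ 0ℚ → Pr d P∧F ≡ 0ℚ
  null PrF≡0 = QP.≤-antisym
    (subst₂ Q._≤_ (sym (Pr≡𝔼 d P∧F)) (trans (sym (Pr≡𝔼 d F)) PrF≡0)
            (𝔼-mono d _ _ nd (λ a → ind-∧-≤ (P a) (F a))))
    (subst (0ℚ Q.≤_) (sym (Pr≡𝔼 d P∧F)) (𝔼-nonneg d _ nd (λ a → ind-nonneg (P∧F a))))

tower : {A : Set} (d : Dist A) → Nonneg d → (κ : A → ℕ) (P : A → Bool) (f : ℕ → ℚ) →
        𝔼 d (λ a → f (κ a) * ind (P a)) ≡
        𝔼 d (λ a → f (κ a) * Cond d P (λ b → κ b ≡ᵇ κ a))
tower d nd κ P f = begin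
    𝔼 d (λ a → f (κ a) * ind (P a))
  ≡⟨ decompose κ d _ ⟩
    sumTo N (λ n → 𝔼 d (λ a → ind (κ a ≡ᵇ n) * (f (κ a) * ind (P a))))
  ≡⟨ sumTo-cong N _ _ slice ⟩
    sumTo N (λ n → 𝔼 d (λ a → ind (κ a ≡ᵇ n) * (f (κ a) * γ (κ a))))
  ≡⟨ decompose κ d _ ⟨
    𝔼 d (λ a → f (κ a) * γ (κ a))
  ∎
  where
  open ≡-Reasoning
  N : ℕ
  N = maxKey κ d
  γ : ℕ → ℚ
  γ n = Cond d P (λ b → κ b ≡ᵇ n)
  -- both sides restricted to the event "κ = n" equal f n · Pr[P ∧ κ = n]
  slice : ∀ n → 𝔼 d (λ a → ind (κ a ≡ᵇ n) * (f (κ a) * ind (P a))) ≡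
                𝔼 d (λ a → ind (κ a ≡ᵇ n) * (f (κ a) * γ (κ a)))
  slice n = begin
      𝔼 d (λ a → ind (κ a ≡ᵇ n) * (f (κ a) * ind (P a)))
    ≡⟨ 𝔼-congᵘ d _ _ (λ a → begin
         ind (κ a ≡ᵇ n) * (f (κ a) * ind (P a))
       ≡⟨ localize (κ a) n (λ c → f c * ind (P a)) ⟩
         f n * ind (P a) * ind (κ a ≡ᵇ n)
       ≡⟨ QP.*-assoc (f n) _ _ ⟩
         f n * (ind (P a) * ind (κ a ≡ᵇ n))
       ≡⟨ cong (f n *_) (ind-∧ (P a) (κ a ≡ᵇ n)) ⟨
         f n * ind (P a ∧ (κ a ≡ᵇ n))
       ∎) ⟩
      𝔼 d (λ a → f n * ind (P a ∧ (κ a ≡ᵇ n)))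
    ≡⟨ 𝔼-* d (f n) _ ⟩
      f n * 𝔼 d (λ a → ind (P a ∧ (κ a ≡ᵇ n)))
    ≡⟨ cong (f n *_) (trans (sym (Pr≡𝔼 d _)) (sym (Cond-cancel d nd P (λ b → κ b ≡ᵇ n)))) ⟩
      f n * (γ n * Pr d (λ b → κ b ≡ᵇ n))
    ≡⟨ sym (QP.*-assoc (f n) (γ n) _) ⟩
      f n * γ n * Pr d (λ b → κ b ≡ᵇ n)
    ≡⟨ cong (f n * γ n *_) (Pr≡𝔼 d _) ⟩
      f n * γ n * 𝔼 d (λ a → ind (κ a ≡ᵇ n))
    ≡⟨ 𝔼-* d (f n * γ n) _ ⟨
      𝔼 d (λ a → f n * γ n * ind (κ a ≡ᵇ n))
    ≡⟨ 𝔼-congᵘ d _ _ (λ a → localize (κ a) n (λ c → f c * γ c)) ⟨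
      𝔼 d (λ a → ind (κ a ≡ᵇ n) * (f (κ a) * γ (κ a)))
    ∎

inverse-nonneg : ∀ b (b≢0 : ¬ b ≡ 0ℚ) → 0ℚ Q.≤ b → 0ℚ Q.≤ (1/ b) {{Q.≢-nonZero b≢0}}
inverse-nonneg b b≢0 0≤b = QP.nonNegative⁻¹ 1/b {{QP.pos⇒nonNeg 1/b {{QP.1/pos⇒pos b {{b>0}}}}}}
  where
  b>0 : Q.Positive b
  b>0 = QP.nonNeg∧nonZero⇒pos b {{Q.nonNegative 0≤b}} {{Q.≢-nonZero b≢0}}
  1/b : ℚ
  1/b = (1/ b) {{Q.≢-nonZero b≢0}}

divQ-nonneg : ∀ a b → 0ℚ Q.≤ a → 0ℚ Q.≤ b → 0ℚ Q.≤ divQ a b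
divQ-nonneg a b 0≤a 0≤b with b QP.≟ 0ℚ
... | yes _ = QP.≤-refl
... | no b≢0 = 0≤* 0≤a (inverse-nonneg b b≢0 0≤b)

divQ-≤1 : ∀ a b → 0ℚ Q.< b → a Q.≤ b → divQ a b Q.≤ 1ℚ
divQ-≤1 a b 0<b a≤b with b QP.≟ 0ℚ
... | yes _ = 0≤1
... | no b≢0 = subst (a * (1/ b) {{Q.≢-nonZero b≢0}} Q.≤_) (QP.*-inverseʳ b {{Q.≢-nonZero b≢0}})
                 (QP.*-monoʳ-≤-nonNeg _ {{Q.nonNegative (inverse-nonneg b b≢0 (QP.<⇒≤ 0<b))}} a≤b)

1-x-nonneg : ∀ x → x Q.≤ 1ℚ → 0ℚ Q.≤ 1ℚ - x
1-x-nonneg x x≤1 = subst (Q._≤ 1ℚ - x) (QP.+-inverseʳ x) (QP.+-monoˡ-≤ (- x) x≤1)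

sumQ-nonneg : (xs : List ℚ) → All (0ℚ Q.≤_) xs → 0ℚ Q.≤ sumQ xs
sumQ-nonneg [] [] = QP.≤-refl
sumQ-nonneg (x ∷ xs) (p ∷ ps) = 0≤+ p (sumQ-nonneg xs ps)

-- the prices offered from level ℓ are r^(ℓ+1), ..., r^(m)
offset-bound : ∀ ℓ m i → i < m ∸ ℓ → suc (ℓ Nat.+ i) ≤ m
offset-bound zero m i lt = lt
offset-bound (suc ℓ) (suc m) i lt = s≤s (offset-bound ℓ m i lt)

module _ (m : ℕ) (r : ℕ → ℚ) (r0≡0 : r 0 ≡ 0ℚ)
         (r-mono : ∀ i j → i < j → j ≤ m → r i Q.< r j) where

  -- q^(j) = 1 - r^(j-1)/r^(j) ≥ 0, as 0 < r^(j) and r^(j-1) < r^(j).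
  qq-nonneg : ∀ j → 1 ≤ j → j ≤ m → 0ℚ Q.≤ qq r j
  qq-nonneg (suc j) _ j<m = 1-x-nonneg _ (divQ-≤1 _ _ 0<r (QP.<⇒≤ (r-mono j (suc j) (NP.n<1+n j) j<m)))
    where
    0<r : 0ℚ Q.< r (suc j)
    0<r = subst (Q._< r (suc j)) r0≡0 (r-mono 0 (suc j) (s≤s z≤n) j<m)

  offer-nonneg : ∀ ℓ → Nonneg (offerDist m r ℓ)
  offer-nonneg ℓ = Nonneg-if (m Nat.≤ᵇ ℓ) (0≤1 ∷ [])
    (AllP.map⁺ (All.map (λ 0≤q → divQ-nonneg _ _ 0≤q (sumQ-nonneg _ (AllP.map⁺ q-nonneg))) q-nonneg))
    where
    js : List ℕ
    js = map (λ i → suc ℓ Nat.+ i) (upTo (m ∸ ℓ))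
    q-nonneg : All (λ j → 0ℚ Q.≤ qq r j) js
    q-nonneg = AllP.map⁺ (All.map (λ {i} i<m-ℓ →
                                     qq-nonneg (suc ℓ Nat.+ i) (s≤s z≤n) (offset-bound ℓ m i i<m-ℓ))
                                  (AllP.all-upTo (m ∸ ℓ)))

-- Coupling VT and VT'

module Coupling (m k : ℕ) (r : ℕ → ℚ) (choose : Vec (Fin (suc m)) k → Fin k)
                (offer-nonneg : ∀ ℓ → Nonneg (offerDist m r ℓ)) where

  St : Set
  St = StVT m k

  St' : Set
  St' = StVT' m k

  offer : Vec (Fin (suc m)) k → Dist ℕ
  offer L = offerDist m r (toℕ (lookup L (choose L)))

  soldMin : St → Bool
  soldMin s = lookup (sd s) (choose (lv s))

  γ : Dist St → ℕ → ℚ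
  γ d c = Cond d soldMin (λ s → cnt s ≡ᵇ c)

  priceVT : St → Dist ℕ
  priceVT s = if soldMin s then ret (suc m) else offer (lv s)

  priceVT' : Dist St → St' → Dist ℕ
  priceVT' d s' = scale (1ℚ - γ d (cnt' s')) (offer (lv' s')) ++ scale (γ d (cnt' s')) (ret (suc m))

  sale : Fin (suc m) → ℕ → ℕ
  sale v p = if sells m v p then 1 else 0

  nextVT : St → Fin (suc m) → ℕ → St
  nextVT s v p = stVT (lv s [ choose (lv s) ]≔ maxF (lookup (lv s) (choose (lv s))) v)
                      (if sells m v p then sd s [ choose (lv s) ]≔ true else sd s)
                      (cnt s Nat.+ sale v p)

  nextVT' : St' → Fin (suc m) → ℕ → St'
  nextVT' s' v p = stVT' (lv' s' [ choose (lv' s') ]≔ maxF (lookup (lv' s') (choose (lv' s'))) v)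
                         (cnt' s' Nat.+ sale v p)

  𝔼-stepVT : {C : Set} (d : Dist St) (v : Fin (suc m)) (F : St → ℕ × St → C) (h : C → ℚ) →
             𝔼 (bindD d (λ s → mapD (F s) (stepVT m k r choose s v))) h ≡
             𝔼 d (λ s → 𝔼 (priceVT s) (λ p → h (F s (p , nextVT s v p))))
  𝔼-stepVT d v F h =
    trans (𝔼-bind-map d (λ s → stepVT m k r choose s v) F h)
          (𝔼-congᵘ d _ _ (λ s → 𝔼-mapD (λ p → p , nextVT s v p) (priceVT s) (λ ps → h (F s ps))))

  𝔼-stepVT' : {C : Set} (d : Dist St) (d' : Dist St') (v : Fin (suc m))
              (F : St' → ℕ × St' → C) (h : C → ℚ) →
              𝔼 (bindD d' (λ s' → mapD (F s') (stepVT' m k r choose d s' v))) h ≡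
              𝔼 d' (λ s' → 𝔼 (priceVT' d s') (λ p → h (F s' (p , nextVT' s' v p))))
  𝔼-stepVT' d d' v F h =
    trans (𝔼-bind-map d' (λ s' → stepVT' m k r choose d s' v) F h)
          (𝔼-congᵘ d' _ _ (λ s' →
             𝔼-mapD (λ p → p , nextVT' s' v p) (priceVT' d s') (λ ps → h (F s' ps))))

  𝔼-soldOrOffer : (b : Bool) (O : Dist ℕ) (φ : ℕ → ℚ) →
                  𝔼 (if b then ret (suc m) else O) φ ≡ 𝔼 O φ + (φ (suc m) - 𝔼 O φ) * ind b
  𝔼-soldOrOffer true O φ =
    trans (𝔼-ret (suc m) φ) (solve 2 (λ e o → e := o :+ (e :- o) :* con 1ℚ) refl (φ (suc m)) (𝔼 O φ))
  𝔼-soldOrOffer false O φ = solve 2 (λ e o → o := o :+ (e :- o) :* con 0ℚ) refl (φ (suc m)) (𝔼 O φ)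

  𝔼-mixture : (g : ℚ) (O : Dist ℕ) (φ : ℕ → ℚ) →
              𝔼 (scale (1ℚ - g) O ++ scale g (ret (suc m))) φ ≡ 𝔼 O φ + (φ (suc m) - 𝔼 O φ) * g
  𝔼-mixture g O φ = begin
      𝔼 (scale (1ℚ - g) O ++ scale g (ret (suc m))) φ
    ≡⟨ 𝔼-++ (scale (1ℚ - g) O) _ φ ⟩
      𝔼 (scale (1ℚ - g) O) φ + 𝔼 (scale g (ret (suc m))) φ
    ≡⟨ cong₂ _+_ (𝔼-scale (1ℚ - g) O φ)
                 (trans (𝔼-scale g (ret (suc m)) φ) (cong (g *_) (𝔼-ret (suc m) φ))) ⟩
      (1ℚ - g) * 𝔼 O φ + g * φ (suc m)
    ≡⟨ solve 3 (λ g o e → (con 1ℚ :- g) :* o :+ g :* e := o :+ (e :- o) :* g)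
               refl g (𝔼 O φ) (φ (suc m)) ⟩
      𝔼 O φ + (φ (suc m) - 𝔼 O φ) * g
    ∎
    where open ≡-Reasoning

  record Coupled (d : Dist St) (d' : Dist St') : Set where
    field
      levels        : Vec (Fin (suc m)) k
      levels-VT     : All (λ ws → lv (proj₂ ws) ≡ levels) d
      levels-VT'    : All (λ ws → lv' (proj₂ ws) ≡ levels) d'
      nonneg        : Nonneg d
      sameSalesLaw  : (G : ℕ → ℚ) → 𝔼 d (λ s → G (cnt s)) ≡ 𝔼 d' (λ s' → G (cnt' s'))

  samePriceLaw : (d : Dist St) (d' : Dist St') → Coupled d d' → (Ψ : ℕ → ℕ → ℚ) →
                 𝔼 d (λ s → 𝔼 (priceVT s) (λ p → Ψ p (cnt s))) ≡
                 𝔼 d' (λ s' → 𝔼 (priceVT' d s') (λ p → Ψ p (cnt' s')))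
  samePriceLaw d d' coupled Ψ = begin
      𝔼 d (λ s → 𝔼 (priceVT s) (λ p → Ψ p (cnt s)))
    ≡⟨ 𝔼-cong d _ _ (All.map (λ {ws} → valueVT (proj₂ ws)) levels-VT) ⟩
      𝔼 d (λ s → o (cnt s) + Δ (cnt s) * ind (soldMin s))
    ≡⟨ 𝔼-+ d _ _ ⟩
      𝔼 d (λ s → o (cnt s)) + 𝔼 d (λ s → Δ (cnt s) * ind (soldMin s))
    ≡⟨ cong (𝔼 d (λ s → o (cnt s)) +_) (tower d nonneg cnt soldMin Δ) ⟩
      𝔼 d (λ s → o (cnt s)) + 𝔼 d (λ s → Δ (cnt s) * γ d (cnt s))
    ≡⟨ 𝔼-+ d _ _ ⟨
      𝔼 d (λ s → o (cnt s) + Δ (cnt s) * γ d (cnt s))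
    ≡⟨ sameSalesLaw (λ c → o c + Δ c * γ d c) ⟩
      𝔼 d' (λ s' → o (cnt' s') + Δ (cnt' s') * γ d (cnt' s'))
    ≡⟨ 𝔼-cong d' _ _ (All.map (λ {ws} → valueVT' (proj₂ ws)) levels-VT') ⟨
      𝔼 d' (λ s' → 𝔼 (priceVT' d s') (λ p → Ψ p (cnt' s')))
    ∎
    where
    open ≡-Reasoning
    open Coupled coupled
    o Δ : ℕ → ℚ
    o c = 𝔼 (offer levels) (λ p → Ψ p c)
    Δ c = Ψ (suc m) c - o c
    valueVT : ∀ s → lv s ≡ levels →
              𝔼 (priceVT s) (λ p → Ψ p (cnt s)) ≡ o (cnt s) + Δ (cnt s) * ind (soldMin s)
    valueVT (stVT l sv c) refl = 𝔼-soldOrOffer (lookup sv (choose l)) (offer l) (λ p → Ψ p c)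
    valueVT' : ∀ s' → lv' s' ≡ levels →
               𝔼 (priceVT' d s') (λ p → Ψ p (cnt' s')) ≡ o (cnt' s') + Δ (cnt' s') * γ d (cnt' s')
    valueVT' (stVT' l c) refl = 𝔼-mixture (γ d c) (offer l) (λ p → Ψ p c)

  stepLaws : Dist St × Dist St' → Fin (suc m) → Dist St × Dist St'
  stepLaws (d , d') v = bindD d (λ s → mapD proj₂ (stepVT m k r choose s v))
                      , bindD d' (λ s' → mapD proj₂ (stepVT' m k r choose d s' v))

  -- One customer preserves the coupling: the new sales count is a function
  -- of the offered price and the old count, whose joint laws agree.
  step-Coupled : (d : Dist St) (d' : Dist St') (v : Fin (suc m)) → Coupled d d' →
                 Coupled (proj₁ (stepLaws (d , d') v)) (proj₂ (stepLaws (d , d') v))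
  step-Coupled d d' v coupled = record
    { levels = newLevels
    ; levels-VT = support-bind d _ (All.map (λ {ws} → nextLevels (proj₂ ws)) levels-VT)
    ; levels-VT' = support-bind d' _ (All.map (λ {ws} → nextLevels' (proj₂ ws)) levels-VT')
    ; nonneg = Nonneg-bind d _ nonneg (λ s → AllP.map⁺ (AllP.map⁺ (priceVT-nonneg s)))
    ; sameSalesLaw = λ G → begin
        𝔼 (proj₁ (stepLaws (d , d') v)) (λ s → G (cnt s))
      ≡⟨ 𝔼-stepVT d v (λ _ → proj₂) (λ s → G (cnt s)) ⟩
        𝔼 d (λ s → 𝔼 (priceVT s) (λ p → G (cnt s Nat.+ sale v p)))
      ≡⟨ samePriceLaw d d' coupled (λ p c → G (c Nat.+ sale v p)) ⟩
        𝔼 d' (λ s' → 𝔼 (priceVT' d s') (λ p → G (cnt' s' Nat.+ sale v p)))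
      ≡⟨ 𝔼-stepVT' d d' v (λ _ → proj₂) (λ s' → G (cnt' s')) ⟨
        𝔼 (proj₂ (stepLaws (d , d') v)) (λ s' → G (cnt' s'))
      ∎
    }
    where
    open ≡-Reasoning
    open Coupled coupled
    newLevels : Vec (Fin (suc m)) k
    newLevels = levels [ choose levels ]≔ maxF (lookup levels (choose levels)) v
    nextLevels : ∀ s → lv s ≡ levels →
                 All (λ ws → lv (proj₂ ws) ≡ newLevels) (mapD proj₂ (stepVT m k r choose s v))
    nextLevels s@(stVT l sv c) refl = AllP.map⁺ (AllP.map⁺ (All.universal (λ _ → refl) (priceVT s)))
    nextLevels' : ∀ s' → lv' s' ≡ levels →
                  All (λ ws → lv' (proj₂ ws) ≡ newLevels) (mapD proj₂ (stepVT' m k r choose d s' v))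
    nextLevels' s'@(stVT' l c) refl =
      AllP.map⁺ (AllP.map⁺ (All.universal (λ _ → refl) (priceVT' d s')))
    priceVT-nonneg : ∀ s → Nonneg (priceVT s)
    priceVT-nonneg s = Nonneg-if (soldMin s) (0≤1 ∷ []) (offer-nonneg _)

  runs-Coupled : (vs : List (Fin (suc m))) (d : Dist St) (d' : Dist St') → Coupled d d' →
                 Coupled (proj₁ (runs m k r choose (d , d') vs)) (proj₂ (runs m k r choose (d , d') vs))
  runs-Coupled [] d d' coupled = coupled
  runs-Coupled (v ∷ vs) d d' coupled = runs-Coupled vs _ _ (step-Coupled d d' v coupled)

  distsAt-Coupled : {T : ℕ} (Vs : Vec (Fin (suc m)) T) (t : ℕ) →
                    Coupled (proj₁ (distsAt m k r choose Vs t)) (proj₂ (distsAt m k r choose Vs t))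
  distsAt-Coupled Vs t = runs-Coupled (take t (toList Vs)) _ _ record
    { levels = replicate k Data.Fin.zero
    ; levels-VT = refl ∷ []
    ; levels-VT' = refl ∷ []
    ; nonneg = 0≤1 ∷ []
    ; sameSalesLaw = λ G → refl
    }

  sameInventory : {T : ℕ} (Vs : Vec (Fin (suc m)) T) (t k' : ℕ) →
                  PrInvVT' m k r choose Vs t k' ≡ PrInvVT m k r choose Vs t k'
  sameInventory Vs t k' = begin
      Pr d' (λ s' → invIs k k' (cnt' s'))
    ≡⟨ Pr≡𝔼 d' _ ⟩
      𝔼 d' (λ s' → ind (invIs k k' (cnt' s')))
    ≡⟨ Coupled.sameSalesLaw (distsAt-Coupled Vs t) (λ c → ind (invIs k k' c)) ⟨
      𝔼 d (λ s → ind (invIs k k' (cnt s)))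
    ≡⟨ Pr≡𝔼 d _ ⟨
      Pr d (λ s → invIs k k' (cnt s))
    ∎
    where
    open ≡-Reasoning
    d = proj₁ (distsAt m k r choose Vs t)
    d' = proj₂ (distsAt m k r choose Vs t)

  sameJointLaw : {T : ℕ} (Vs : Vec (Fin (suc m)) T) (t : Fin T) (E : ℕ × ℕ → Bool) →
                 Pr (jointVT' m k r choose Vs t) E ≡ Pr (jointVT m k r choose Vs t) E
  sameJointLaw Vs t E = begin
      Pr (jointVT' m k r choose Vs t) E
    ≡⟨ Pr≡𝔼 (jointVT' m k r choose Vs t) E ⟩
      𝔼 (jointVT' m k r choose Vs t) (λ pc → ind (E pc))
    ≡⟨ 𝔼-stepVT' d d' v (λ s' ps → proj₁ ps , cnt' s') (λ pc → ind (E pc)) ⟩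
      𝔼 d' (λ s' → 𝔼 (priceVT' d s') (λ p → ind (E (p , cnt' s'))))
    ≡⟨ samePriceLaw d d' (distsAt-Coupled Vs (toℕ t)) (λ p c → ind (E (p , c))) ⟨
      𝔼 d (λ s → 𝔼 (priceVT s) (λ p → ind (E (p , cnt s))))
    ≡⟨ 𝔼-stepVT d v (λ s ps → proj₁ ps , cnt s) (λ pc → ind (E pc)) ⟨
      𝔼 (jointVT m k r choose Vs t) (λ pc → ind (E pc))
    ≡⟨ Pr≡𝔼 (jointVT m k r choose Vs t) E ⟨
      Pr (jointVT m k r choose Vs t) E
    ∎
    where
    open ≡-Reasoning
    d = proj₁ (distsAt m k r choose Vs (toℕ t))
    d' = proj₂ (distsAt m k r choose Vs (toℕ t))
    v = lookup Vs t

  sameCondPrice : {T : ℕ} (Vs : Vec (Fin (suc m)) T) (t : Fin T) (k' j : ℕ) →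
                  CondPriceVT' m k r choose Vs t k' j ≡ CondPriceVT m k r choose Vs t k' j
  sameCondPrice Vs t k' j =
    cong₂ divQ (sameJointLaw Vs t (λ pc → (proj₁ pc ≡ᵇ j) ∧ invIs k k' (proj₂ pc)))
               (sameJointLaw Vs t (λ pc → invIs k k' (proj₂ pc)))

lemma2 : (m k T : ℕ) → 1 ≤ m → 1 ≤ k →
         (r : ℕ → ℚ) → r 0 ≡ 0ℚ →
         (∀ i j → i < j → j ≤ m → Data.Rational._<_ (r i) (r j)) →
         (choose : Vec (Fin (suc m)) k → Fin k) → IsMinChoice choose →
         (Vs : Vec (Fin (suc m)) T) →
         ((t : Fin T) (k' : ℕ) → k' ≤ k →
            Data.Rational._<_ 0ℚ (PrInvVT' m k r choose Vs (toℕ t) k') →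
            (j : ℕ) → 1 ≤ j → j ≤ suc m →
            CondPriceVT' m k r choose Vs t k' j ≡ CondPriceVT m k r choose Vs t k' j)
         ×
         ((t : ℕ) → t ≤ T → (k' : ℕ) → k' ≤ k →
            PrInvVT' m k r choose Vs t k' ≡ PrInvVT m k r choose Vs t k')
lemma2 m k T _ _ r r0≡0 r-mono choose _ Vs =
    (λ t k' _ _ j _ _ → sameCondPrice Vs t k' j)
  , (λ t _ k' _ → sameInventory Vs t k')
  where open Coupling m k r choose (offer-nonneg m r r0≡0 r-mono)
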